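{- Let $G$ be a graph containing a triangle $u_1u_2u_3$ such that $d_G(u_1)=2$ and $d_G(u_2)=3$ with $N_G(u_2)=\{u_1,u_3,u_4\}$. Let $D$ be an orientation of $G$ in which the edges incident with $u_1$ or $u_2$ are oriented as $(u_1,u_3),(u_2,u_1),(u_2,u_3),(u_4,u_2)$, and let $D'=D-\{u_1,u_2\}$. Then $\mathrm{diff}(D)=\mathrm{diff}(D')$. In particular, $D$ is an AT-orientation if and only if $D'$ is an AT-orientation.
   Context: For an orientation $D$ of a graph, an Eulerian sub-digraph is a spanning sub-digraph $F$ with $d_F^+(v)=d_F^-(v)$ for every vertex $v$; $\mathrm{diff}(D)$ is the number of Eulerian sub-digraphs with an even number of arcs minus the number with an odd number of arcs; $D$ is an AT-orientation if $\mathrm{diff}(D)\ne0$. -}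

module Defs where

open import Data.Bool using (Bool; true; false; _∧_; _xor_; if_then_else_)
open import Data.Nat using (ℕ; zero; suc; _+_; _≡ᵇ_)
open import Data.Nat.Properties using ()
open import Data.Integer using (ℤ; 0ℤ; 1ℤ; -1ℤ) renaming (_+_ to _+ℤ_)
open import Data.Fin using (Fin; zero; suc; punchIn; punchOut)
open import Data.List using (List; []; _∷_; map; concatMap; foldr)
open import Data.Product using (_×_)
open import Data.Sum using (_⊎_)
open import Relation.Binary.PropositionalEquality using (_≡_; _≢_)
open import Relation.Nullary using (¬_)

-- For a digraph, D u v ≡ true means that (u , v) is an arc.
Rel : ℕ → Set
Rel n = Fin n → Fin n → Bool

IsGraph : {n : ℕ} → Rel n → Set
IsGraph {n} G = (∀ u v → G u v ≡ G v u) × (∀ u → G u u ≡ false)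

IsOrientation : {n : ℕ} → Rel n → Rel n → Set
IsOrientation {n} G D =
  (∀ u v → D u v ≡ true → G u v ≡ true) ×
  (∀ u v → G u v ≡ true → (D u v xor D v u) ≡ true)

count : {n : ℕ} → (Fin n → Bool) → ℕ
count {zero} f = 0
count {suc n} f = (if f zero then 1 else 0) + count (λ i → f (suc i))

allB : {n : ℕ} → (Fin n → Bool) → Bool
allB {zero} f = true
allB {suc n} f = f zero ∧ allB (λ i → f (suc i))

sumℕ : {n : ℕ} → (Fin n → ℕ) → ℕ
sumℕ {zero} f = 0
sumℕ {suc n} f = f zero + sumℕ (λ i → f (suc i))

degree : {n : ℕ} → Rel n → Fin n → ℕ
degree G v = count (G v)

outdeg : {n : ℕ} → Rel n → Fin n → ℕ
outdeg D v = count (D v)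

indeg : {n : ℕ} → Rel n → Fin n → ℕ
indeg D v = count (λ u → D u v)

arcCount : {n : ℕ} → Rel n → ℕ
arcCount D = sumℕ (outdeg D)

subB : {n : ℕ} → Rel n → Rel n → Bool
subB F D = allB (λ u → allB (λ v → if F u v then D u v else true))

eulerianB : {n : ℕ} → Rel n → Bool
eulerianB F = allB (λ v → outdeg F v ≡ᵇ indeg F v)

allFuns : {A : Set} → (n : ℕ) → List A → List (Fin n → A)
allFuns zero xs = (λ ()) ∷ []
allFuns (suc n) xs =
  concatMap (λ a → map (λ f → λ { zero → a ; (suc i) → f i }) (allFuns n xs)) xs

allRels : (n : ℕ) → List (Rel n)
allRels n = allFuns n (allFuns n (true ∷ false ∷ []))

sign : ℕ → ℤ
sign zero = 1ℤ
sign (suc zero) = -1ℤ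
sign (suc (suc k)) = sign k

-- diff(D) = #(even Eulerian sub-digraphs) − #(odd Eulerian sub-digraphs)
--         = Σ_{F Eulerian spanning sub-digraph of D} (-1)^{|A(F)|}.
diff : {n : ℕ} → Rel n → ℤ
diff {n} D =
  foldr _+ℤ_ 0ℤ
    (map (λ F → if subB F D ∧ eulerianB F then sign (arcCount F) else 0ℤ) (allRels n))

IsAT : {n : ℕ} → Rel n → Set
IsAT D = ¬ (diff D ≡ 0ℤ)

-- Deleting a vertex v (the remaining vertices are re-indexed by punchIn v).
deleteVertex : {n : ℕ} → Fin (suc n) → Rel (suc n) → Rel n
deleteVertex v D i j = D (punchIn v i) (punchIn v j)

delete2 : {n : ℕ} (u₁ u₂ : Fin (suc (suc n))) → u₁ ≢ u₂ → Rel (suc (suc n)) → Rel n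
delete2 u₁ u₂ ne D = deleteVertex (punchOut ne) (deleteVertex u₁ D)

module Submission where

-- Generalise diff to diffWith α β D, the signed count of the sub-digraphs F ⊆ D that become
-- Eulerian once every vertex v receives α v extra out-arcs and β v extra in-arcs. If u has a single
-- out-neighbour p and a single in-neighbour q, sort the F by whether they use the arcs up and qu:
-- the balance at u forces both or neither when α u = β u, and only qu when α u = β u + 1, while
-- the arcs used are recorded in β p and α q on D − u. Deleting u₁ (arcs u₂u₁, u₁u₃) and then u₂
-- (arcs u₄u₂, u₂u₃) in this way gives diff D = (diff D′ + Y) − Y: the sub-digraphs through
-- u₄u₂u₃ and through u₄u₂u₁u₃ cancel in pairs (two arcs against three), and those avoiding u₁
-- and u₂ are the sub-digraphs of D′.

open import Defs
open import Algebra.Bundles using (CommutativeMonoid)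
import Algebra.Properties.CommutativeSemigroup as CommSemigroupProperties
open import Data.Bool using (Bool; true; false; _∧_; _xor_; if_then_else_)
open import Data.Bool.Properties using (¬-not; ∧-zeroʳ; ∧-commutativeMonoid)
open import Data.Empty using (⊥; ⊥-elim)
open import Data.Fin using (Fin; zero; suc; punchIn; punchOut)
open import Data.Fin.Properties
  using (_≟_; punchInᵢ≢i; punchIn-punchOut; punchIn-injective; punchOut-injective)
open import Data.Integer using (ℤ; 0ℤ; 1ℤ; -1ℤ; -_; _*_) renaming (_+_ to _+ℤ_)
import Data.Integer.Properties as ℤ
open import Data.Integer.Tactic.RingSolver using (solve-∀)
open import Data.List using (List; []; _∷_; _++_; map; concatMap; foldr)
open import Data.Nat using (ℕ; zero; suc; _+_; _≡ᵇ_)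
import Data.Nat.Properties as ℕ
open import Data.Product using (_×_; _,_; proj₁; proj₂)
open import Data.Sum using (_⊎_; inj₁; inj₂; [_,_]′; assocˡ; swap)
open import Data.Vec.Functional using (Vector; insertAt; removeAt)
open import Data.Vec.Functional.Properties
  using (insertAt-lookup; insertAt-punchIn; removeAt-punchOut)
import Data.Vec.Functional.Relation.Binary.Equality.Setoid as VecSetoid
open import Function using (_∘_; id)
open import Function.Bundles using (_⇔_; mk⇔; Equivalence)
open import Function.Definitions using (Congruent)
open import Level using (0ℓ)
open import Relation.Binary.Bundles using (Setoid)
open import Relation.Binary.PropositionalEquality
open import Relation.Nullary using (yes; no; contradiction)

open CommSemigroupProperties ℕ.+-commutativeSemigroup using ()
  renaming (x∙yz≈y∙xz to +-left-comm; interchange to +-interchange)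
open CommSemigroupProperties (CommutativeMonoid.commutativeSemigroup ∧-commutativeMonoid) using ()
  renaming (x∙yz≈y∙xz to ∧-left-comm; interchange to ∧-interchange)
open CommSemigroupProperties ℤ.+-commutativeSemigroup using ()
  renaming (interchange to +ℤ-interchange)
open VecSetoid (setoid Bool) using () renaming (_≋_ to _≋ᵇ_; ≋-setoid to RowSetoid)
open Equivalence using (to; from)

-- Sums over lists

∑ : {A : Set} → List A → (A → ℤ) → ℤ
∑ xs h = foldr _+ℤ_ 0ℤ (map h xs)

syntax ∑ xs (λ x → e) = ∑[ x ∈ xs ] e

module _ {A : Set} where

  ∑-cong : (xs : List A) {h h′ : A → ℤ} → (∀ x → h x ≡ h′ x) → ∑ xs h ≡ ∑ xs h′
  ∑-cong []       _  = refl
  ∑-cong (x ∷ xs) eq = cong₂ _+ℤ_ (eq x) (∑-cong xs eq)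

  ∑-zero : (xs : List A) {h : A → ℤ} → (∀ x → h x ≡ 0ℤ) → ∑ xs h ≡ 0ℤ
  ∑-zero []       _  = refl
  ∑-zero (x ∷ xs) eq = cong₂ _+ℤ_ (eq x) (∑-zero xs eq)

  ∑-++ : (xs ys : List A) (h : A → ℤ) → ∑ (xs ++ ys) h ≡ ∑ xs h +ℤ ∑ ys h
  ∑-++ []       ys h = sym (ℤ.+-identityˡ _)
  ∑-++ (x ∷ xs) ys h = trans (cong (h x +ℤ_) (∑-++ xs ys h)) (sym (ℤ.+-assoc (h x) _ _))

  ∑-+ : (xs : List A) (h h′ : A → ℤ) → ∑[ x ∈ xs ] (h x +ℤ h′ x) ≡ ∑ xs h +ℤ ∑ xs h′
  ∑-+ []       h h′ = refl
  ∑-+ (x ∷ xs) h h′ =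
    trans (cong (h x +ℤ h′ x +ℤ_) (∑-+ xs h h′)) (+ℤ-interchange (h x) (h′ x) _ _)

  ∑-*ˡ : (k : ℤ) (xs : List A) (h : A → ℤ) → ∑[ x ∈ xs ] (k * h x) ≡ k * ∑ xs h
  ∑-*ˡ k []       h = sym (ℤ.*-zeroʳ k)
  ∑-*ˡ k (x ∷ xs) h = trans (cong (k * h x +ℤ_) (∑-*ˡ k xs h)) (sym (ℤ.*-distribˡ-+ k (h x) _))

  ∑-if-*ˡ : (c : Bool) (k : ℤ) (xs : List A) (h : A → ℤ) →
    ∑[ x ∈ xs ] (if c then k * h x else 0ℤ) ≡ (if c then k * ∑ xs h else 0ℤ)
  ∑-if-*ˡ true  k xs h = ∑-*ˡ k xs h
  ∑-if-*ˡ false k xs h = ∑-zero xs (λ _ → refl)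

module _ {A B : Set} where

  ∑-map : (f : A → B) (xs : List A) (h : B → ℤ) → ∑ (map f xs) h ≡ ∑[ x ∈ xs ] h (f x)
  ∑-map f []       h = refl
  ∑-map f (x ∷ xs) h = cong (h (f x) +ℤ_) (∑-map f xs h)

  ∑-concatMap : (f : A → List B) (xs : List A) (h : B → ℤ) →
    ∑ (concatMap f xs) h ≡ ∑[ x ∈ xs ] ∑ (f x) h
  ∑-concatMap f []       h = refl
  ∑-concatMap f (x ∷ xs) h = trans (∑-++ (f x) _ h) (cong (∑ (f x) h +ℤ_) (∑-concatMap f xs h))

  ∑-comm : (xs : List A) (ys : List B) (h : A → B → ℤ) →
    ∑[ x ∈ xs ] ∑[ y ∈ ys ] h x y ≡ ∑[ y ∈ ys ] ∑[ x ∈ xs ] h x y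
  ∑-comm []       ys h = sym (∑-zero ys (λ _ → refl))
  ∑-comm (x ∷ xs) ys h = trans (cong (∑ ys (h x) +ℤ_) (∑-comm xs ys h)) (sym (∑-+ ys (h x) _))

-- Sums over all functions Fin n → A

-- Functions Fin n → A are only compared pointwise: allFuns builds them from pattern-matching
-- lambdas, which are not definitionally equal to the insertAt-vectors used below.
Splits : (SA SB SC : Setoid 0ℓ 0ℓ) →
  List (Setoid.Carrier SA) → List (Setoid.Carrier SB) → List (Setoid.Carrier SC) →
  (Setoid.Carrier SB → Setoid.Carrier SC → Setoid.Carrier SA) → Set
Splits SA SB SC xs ys zs φ =
  ∀ h → Congruent (Setoid._≈_ SA) _≡_ h → ∑ xs h ≡ ∑[ y ∈ ys ] ∑[ z ∈ zs ] h (φ y z)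

module _ (S : Setoid 0ℓ 0ℓ) where
  open Setoid S using (_≈_) renaming (Carrier to A; refl to ≈-refl)
  open VecSetoid S using (_≋_; ≋-setoid)

  insertAt-cong : ∀ {n} (u : Fin (suc n)) {f f′ : Vector A n} {a a′ : A} →
    f ≋ f′ → a ≈ a′ → insertAt f u a ≋ insertAt f′ u a′
  insertAt-cong zero f≋f′ a≈a′ zero    = a≈a′
  insertAt-cong zero f≋f′ a≈a′ (suc j) = f≋f′ j
  insertAt-cong {suc n} (suc u) f≋f′ a≈a′ zero    = f≋f′ zero
  insertAt-cong {suc n} (suc u) f≋f′ a≈a′ (suc j) = insertAt-cong u (f≋f′ ∘ suc) a≈a′ j

  allFuns-splits-head : ∀ n (xs : List A) →
    Splits (≋-setoid (suc n)) S (≋-setoid n)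
           (allFuns (suc n) xs) xs (allFuns n xs) (λ a f → insertAt f zero a)
  allFuns-splits-head n xs h h-cong =
    trans (∑-concatMap _ xs h) (∑-cong xs λ a →
      trans (∑-map _ (allFuns n xs) h) (∑-cong (allFuns n xs) λ f →
        h-cong λ { zero → ≈-refl ; (suc i) → ≈-refl }))

  allFuns-splits-insertAt : ∀ {n} (u : Fin (suc n)) (xs : List A) →
    Splits (≋-setoid (suc n)) S (≋-setoid n)
           (allFuns (suc n) xs) xs (allFuns n xs) (λ a f → insertAt f u a)
  allFuns-splits-insertAt zero xs = allFuns-splits-head _ xs
  allFuns-splits-insertAt {suc n} (suc u) xs h h-cong = begin
      ∑ (allFuns (suc (suc n)) xs) h
    ≡⟨ allFuns-splits-head (suc n) xs h h-cong ⟩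
      ∑[ c ∈ xs ] ∑[ f ∈ allFuns (suc n) xs ] h (insertAt f zero c)
    ≡⟨ ∑-cong xs (λ c →
         allFuns-splits-insertAt u xs _ (λ f≋ → h-cong (insertAt-cong zero f≋ ≈-refl))) ⟩
      ∑[ c ∈ xs ] ∑[ a ∈ xs ] ∑[ f ∈ allFuns n xs ] h (insertAt (insertAt f u a) zero c)
    ≡⟨ ∑-comm xs xs _ ⟩
      ∑[ a ∈ xs ] ∑[ c ∈ xs ] ∑[ f ∈ allFuns n xs ] h (insertAt (insertAt f u a) zero c)
    ≡⟨ ∑-cong xs (λ a → ∑-cong xs λ c → ∑-cong (allFuns n xs) λ f →
         h-cong λ { zero → ≈-refl ; (suc i) → ≈-refl }) ⟩
      ∑[ a ∈ xs ] ∑[ c ∈ xs ] ∑[ f ∈ allFuns n xs ] h (insertAt (insertAt f zero c) (suc u) a)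
    ≡⟨ ∑-cong xs (λ a →
         allFuns-splits-head n xs _ (λ f≋ → h-cong (insertAt-cong (suc u) f≋ ≈-refl))) ⟨
      ∑[ a ∈ xs ] ∑[ f ∈ allFuns (suc n) xs ] h (insertAt f (suc u) a)
    ∎
    where open ≡-Reasoning

module _ (SA SB SC : Setoid 0ℓ 0ℓ) where
  open Setoid SA using () renaming (Carrier to A; _≈_ to _≈ᴬ_; refl to ≈ᴬ-refl)
  open Setoid SB using () renaming (Carrier to B; _≈_ to _≈ᴮ_; refl to ≈ᴮ-refl)
  open Setoid SC using () renaming (Carrier to C; _≈_ to _≈ᶜ_; refl to ≈ᶜ-refl)
  open VecSetoid SA using () renaming (≋-setoid to ≋ᴬ-setoid)
  open VecSetoid SB using () renaming (≋-setoid to ≋ᴮ-setoid)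
  open VecSetoid SC using () renaming (≋-setoid to ≋ᶜ-setoid)

  allFuns-splits-pointwise : {xs : List A} {ys : List B} {zs : List C} {φ : B → C → A} →
    (∀ {b b′ c c′} → b ≈ᴮ b′ → c ≈ᶜ c′ → φ b c ≈ᴬ φ b′ c′) →
    Splits SA SB SC xs ys zs φ →
    ∀ n → Splits (≋ᴬ-setoid n) (≋ᴮ-setoid n) (≋ᶜ-setoid n)
                 (allFuns n xs) (allFuns n ys) (allFuns n zs) (λ f g i → φ (f i) (g i))
  allFuns-splits-pointwise φ-cong split zero H H-cong =
    trans (cong (_+ℤ 0ℤ) (H-cong (λ ()))) (sym (ℤ.+-identityʳ _))
  allFuns-splits-pointwise {xs} {ys} {zs} {φ} φ-cong split (suc n) H H-cong = begin
      ∑ (allFuns (suc n) xs) H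
    ≡⟨ allFuns-splits-head SA n xs H H-cong ⟩
      ∑[ x ∈ xs ] ∑[ F ∈ allFuns n xs ] H (insertAt F zero x)
    ≡⟨ ∑-cong xs (λ x → allFuns-splits-pointwise φ-cong split n _
         (λ F≋ → H-cong (insertAt-cong SA zero F≋ ≈ᴬ-refl))) ⟩
      ∑[ x ∈ xs ] ∑[ f ∈ fs ] ∑[ g ∈ gs ] H (insertAt (φ* f g) zero x)
    ≡⟨ trans (∑-comm xs fs _) (∑-cong fs (λ f → ∑-comm xs gs _)) ⟩
      ∑[ f ∈ fs ] ∑[ g ∈ gs ] ∑[ x ∈ xs ] H (insertAt (φ* f g) zero x)
    ≡⟨ ∑-cong fs (λ f → ∑-cong gs λ g →
         split _ (λ x≈ → H-cong (insertAt-cong SA zero (λ _ → ≈ᴬ-refl) x≈))) ⟩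
      ∑[ f ∈ fs ] ∑[ g ∈ gs ] ∑[ y ∈ ys ] ∑[ z ∈ zs ] H (insertAt (φ* f g) zero (φ y z))
    ≡⟨ ∑-cong fs (λ f → ∑-comm gs ys _) ⟩
      ∑[ f ∈ fs ] ∑[ y ∈ ys ] ∑[ g ∈ gs ] ∑[ z ∈ zs ] H (insertAt (φ* f g) zero (φ y z))
    ≡⟨ ∑-cong fs (λ f → ∑-cong ys λ y → ∑-comm gs zs _) ⟩
      ∑[ f ∈ fs ] ∑[ y ∈ ys ] ∑[ z ∈ zs ] ∑[ g ∈ gs ] H (insertAt (φ* f g) zero (φ y z))
    ≡⟨ ∑-comm fs ys _ ⟩
      ∑[ y ∈ ys ] ∑[ f ∈ fs ] ∑[ z ∈ zs ] ∑[ g ∈ gs ] H (insertAt (φ* f g) zero (φ y z))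
    ≡⟨ ∑-cong ys (λ y → ∑-cong fs λ f → ∑-cong zs λ z → ∑-cong gs λ g →
         H-cong λ { zero → ≈ᴬ-refl ; (suc i) → ≈ᴬ-refl }) ⟩
      ∑[ y ∈ ys ] ∑[ f ∈ fs ] ∑[ z ∈ zs ] ∑[ g ∈ gs ]
        H (φ* (insertAt f zero y) (insertAt g zero z))
    ≡⟨ ∑-cong ys (λ y → ∑-cong fs λ f → allFuns-splits-head SC n zs _
         (λ g≋ → H-cong (λ i → φ-cong ≈ᴮ-refl (g≋ i)))) ⟨
      ∑[ y ∈ ys ] ∑[ f ∈ fs ] ∑[ g ∈ allFuns (suc n) zs ] H (φ* (insertAt f zero y) g)
    ≡⟨ allFuns-splits-head SB n ys _
         (λ f≋ → ∑-cong (allFuns (suc n) zs) λ g → H-cong (λ i → φ-cong (f≋ i) ≈ᶜ-refl)) ⟨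
      ∑[ f ∈ allFuns (suc n) ys ] ∑[ g ∈ allFuns (suc n) zs ] H (φ* f g)
    ∎
    where
    open ≡-Reasoning
    fs : List (Vector B n)
    fs = allFuns n ys
    gs : List (Vector C n)
    gs = allFuns n zs
    φ* : ∀ {k} → Vector B k → Vector C k → Vector A k
    φ* f g i = φ (f i) (g i)

bit : Bool → ℕ
bit b = if b then 1 else 0

count-cong : ∀ {n} {f g : Vector Bool n} → f ≗ g → count f ≡ count g
count-cong {zero}  eq = refl
count-cong {suc n} eq = cong₂ _+_ (cong bit (eq zero)) (count-cong (eq ∘ suc))

allB-cong : ∀ {n} {f g : Vector Bool n} → f ≗ g → allB f ≡ allB g
allB-cong {zero}  eq = refl
allB-cong {suc n} eq = cong₂ _∧_ (eq zero) (allB-cong (eq ∘ suc))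

sumℕ-cong : ∀ {n} {f g : Vector ℕ n} → f ≗ g → sumℕ f ≡ sumℕ g
sumℕ-cong {zero}  eq = refl
sumℕ-cong {suc n} eq = cong₂ _+_ (eq zero) (sumℕ-cong (eq ∘ suc))

count-removeAt : ∀ {n} (f : Vector Bool (suc n)) u → count f ≡ bit (f u) + count (removeAt f u)
count-removeAt f zero = refl
count-removeAt {suc n} f (suc u) =
  trans (cong (bit (f zero) +_) (count-removeAt (f ∘ suc) u))
        (+-left-comm (bit (f zero)) (bit (f (suc u))) _)

allB-removeAt : ∀ {n} (f : Vector Bool (suc n)) u → allB f ≡ f u ∧ allB (removeAt f u)
allB-removeAt f zero = refl
allB-removeAt {suc n} f (suc u) =
  trans (cong (f zero ∧_) (allB-removeAt (f ∘ suc) u)) (∧-left-comm (f zero) (f (suc u)) _)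

sumℕ-removeAt : ∀ {n} (f : Vector ℕ (suc n)) u → sumℕ f ≡ f u + sumℕ (removeAt f u)
sumℕ-removeAt f zero = refl
sumℕ-removeAt {suc n} f (suc u) =
  trans (cong (f zero +_) (sumℕ-removeAt (f ∘ suc) u)) (+-left-comm (f zero) (f (suc u)) _)

allB-∧ : ∀ {n} (f g : Vector Bool n) → allB (λ i → f i ∧ g i) ≡ allB f ∧ allB g
allB-∧ {zero}  f g = refl
allB-∧ {suc n} f g =
  trans (cong ((f zero ∧ g zero) ∧_) (allB-∧ (f ∘ suc) (g ∘ suc))) (∧-interchange (f zero) (g zero) _ _)

allB-true : ∀ {n} {f : Vector Bool n} → (∀ i → f i ≡ true) → allB f ≡ true
allB-true {zero}  _    = refl
allB-true {suc n} all = cong₂ _∧_ (all zero) (allB-true (all ∘ suc))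

allB-false : ∀ {n} (f : Vector Bool n) {i} → f i ≡ false → allB f ≡ false
allB-false {suc n} f {i} fi≡false =
  trans (allB-removeAt f i) (cong (_∧ allB (removeAt f i)) fi≡false)

sumℕ-+ : ∀ {n} (f g : Vector ℕ n) → sumℕ (λ i → f i + g i) ≡ sumℕ f + sumℕ g
sumℕ-+ {zero}  f g = refl
sumℕ-+ {suc n} f g =
  trans (cong (f zero + g zero +_) (sumℕ-+ (f ∘ suc) (g ∘ suc))) (+-interchange (f zero) (g zero) _ _)

sumℕ-bit : ∀ {n} (f : Vector Bool n) → sumℕ (bit ∘ f) ≡ count f
sumℕ-bit {zero}  f = refl
sumℕ-bit {suc n} f = cong (bit (f zero) +_) (sumℕ-bit (f ∘ suc))

count-false : ∀ {n} → count {n} (λ _ → false) ≡ 0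
count-false {zero}  = refl
count-false {suc n} = count-false {n}

count-insertAt : ∀ {n} (f : Vector Bool n) u b → count (insertAt f u b) ≡ bit b + count f
count-insertAt f u b = trans (count-removeAt (insertAt f u b) u)
  (cong₂ _+_ (cong bit (insertAt-lookup f u b)) (count-cong (insertAt-punchIn f u b)))

count-removeAt-true : ∀ {n} (f : Vector Bool (suc n)) x → f x ≡ true →
  count f ≡ suc (count (removeAt f x))
count-removeAt-true f x fx =
  trans (count-removeAt f x) (cong (λ b → bit b + count (removeAt f x)) fx)

count-nonzero : ∀ {n} (f : Vector Bool n) x → f x ≡ true → count f ≢ 0
count-nonzero {suc n} f x fx = ℕ.1+n≢0 ∘ trans (sym (count-removeAt-true f x fx))

count-unique : ∀ {n} {f : Vector Bool n} {x v} → count f ≡ 1 → f x ≡ true → f v ≡ true → v ≡ x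
count-unique {suc n} {f} {x} {v} c₁ fx fv with v ≟ x
... | yes v≡x = v≡x
... | no  v≢x = contradiction (ℕ.suc-injective (trans (sym (count-removeAt-true f x fx)) c₁))
  (count-nonzero (removeAt f x) _ (trans (removeAt-punchOut f (v≢x ∘ sym)) fv))

count-two : ∀ {n} {f : Vector Bool n} {x y v} → count f ≡ 2 → f x ≡ true → f y ≡ true → x ≢ y →
  f v ≡ true → v ≡ x ⊎ v ≡ y
count-two {suc n} {f} {x} {y} {v} c₂ fx fy x≢y fv with v ≟ x
... | yes v≡x = inj₁ v≡x
... | no  v≢x = inj₂ (punchOut-injective (v≢x ∘ sym) x≢y (count-unique {f = removeAt f x}
  (ℕ.suc-injective (trans (sym (count-removeAt-true f x fx)) c₂))
  (trans (removeAt-punchOut f x≢y) fy) (trans (removeAt-punchOut f (v≢x ∘ sym)) fv)))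

indicator : ∀ {n} → Fin n → Bool → Vector Bool n
indicator {suc n} p b = insertAt (λ _ → false) p b

indicator-at : ∀ {n} (p : Fin n) b → indicator p b p ≡ b
indicator-at {suc n} p b = insertAt-lookup _ p b

indicator-≢ : ∀ {n} {p x : Fin n} b → p ≢ x → indicator p b x ≡ false
indicator-≢ {suc n} {p} b p≢x =
  trans (cong (indicator p b) (sym (punchIn-punchOut p≢x))) (insertAt-punchIn _ p b _)

indicator-false : ∀ {n} (p x : Fin n) → indicator p false x ≡ false
indicator-false p x with p ≟ x
... | yes refl = indicator-at p false
... | no  p≢x  = indicator-≢ false p≢x

punchIn≡⇒≡punchOut : ∀ {n} {u w : Fin (suc n)} {v : Fin n} (u≢w : u ≢ w) →
  punchIn u v ≡ w → v ≡ punchOut u≢w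
punchIn≡⇒≡punchOut {u = u} u≢w eq = punchIn-injective u _ _ (trans eq (sym (punchIn-punchOut u≢w)))

indicator-punchIn : ∀ {n} {u p : Fin (suc n)} (u≢p : u ≢ p) b i →
  indicator p b (punchIn u i) ≡ indicator (punchOut u≢p) b i
indicator-punchIn {u = u} {p} u≢p b i with punchOut u≢p ≟ i
... | yes refl = trans (cong (indicator p b) (punchIn-punchOut u≢p))
                       (trans (indicator-at p b) (sym (indicator-at (punchOut u≢p) b)))
... | no  p′≢i = trans (indicator-≢ b (p′≢i ∘ sym ∘ punchIn≡⇒≡punchOut u≢p ∘ sym))
                       (sym (indicator-≢ b p′≢i))

count-indicator : ∀ {n} (p : Fin n) b → count (indicator p b) ≡ bit b
count-indicator {suc n} p b = trans (count-insertAt (λ _ → false) p b)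
  (trans (cong (bit b +_) (count-false {n})) (ℕ.+-identityʳ _))

bools : List Bool
bools = true ∷ false ∷ []

∑-allFuns-false : ∀ n (g : Vector Bool n → ℤ) → Congruent _≋ᵇ_ _≡_ g →
  (∀ f i → f i ≡ true → g f ≡ 0ℤ) → ∑ (allFuns n bools) g ≡ g (λ _ → false)
∑-allFuns-false zero g g-cong _ = trans (ℤ.+-identityʳ _) (g-cong (λ ()))
∑-allFuns-false (suc n) g g-cong vanish = begin
    ∑ (allFuns (suc n) bools) g
  ≡⟨ allFuns-splits-head (setoid Bool) n bools g g-cong ⟩
    ∑[ f ∈ allFuns n bools ] g (insertAt f zero true) +ℤ
    (∑[ f ∈ allFuns n bools ] g (insertAt f zero false) +ℤ 0ℤ)
  ≡⟨ cong₂ _+ℤ_ (∑-zero (allFuns n bools) (λ f → vanish _ zero refl))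
       (cong (_+ℤ 0ℤ) (∑-allFuns-false n _ (λ f≋ → g-cong (insertAt-cong (setoid Bool) zero f≋ refl))
                                        (λ f i → vanish _ (suc i)))) ⟩
    0ℤ +ℤ (g (insertAt (λ _ → false) zero false) +ℤ 0ℤ)
  ≡⟨ trans (ℤ.+-identityˡ _) (ℤ.+-identityʳ _) ⟩
    g (insertAt (λ _ → false) zero false)
  ≡⟨ g-cong (λ { zero → refl ; (suc i) → refl }) ⟩
    g (λ _ → false)
  ∎
  where open ≡-Reasoning

∑-allFuns-indicator : ∀ {n} (p : Fin n) (g : Vector Bool n → ℤ) → Congruent _≋ᵇ_ _≡_ g →
  (∀ f x → p ≢ x → f x ≡ true → g f ≡ 0ℤ) →
  ∑ (allFuns n bools) g ≡ ∑[ b ∈ bools ] g (indicator p b)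
∑-allFuns-indicator {suc n} p g g-cong vanish =
  trans (allFuns-splits-insertAt (setoid Bool) p bools g g-cong) (∑-cong bools λ b →
    ∑-allFuns-false n _ (λ f≋ → g-cong (insertAt-cong (setoid Bool) p f≋ refl)) λ f i fi →
      vanish _ (punchIn p i) (punchInᵢ≢i p i ∘ sym) (trans (insertAt-punchIn f p b i) fi))

_⊆ᵇ_ : ∀ {n} → Vector Bool n → Vector Bool n → Bool
r ⊆ᵇ X = allB (λ j → if r j then X j else true)

⊆ᵇ-cong : ∀ {n} {r r′ X : Vector Bool n} → r ≗ r′ → r ⊆ᵇ X ≡ r′ ⊆ᵇ X
⊆ᵇ-cong {X = X} eq = allB-cong (λ j → cong (if_then X j else true) (eq j))

⊆ᵇ-false : ∀ {n} {r X : Vector Bool n} {x} → r x ≡ true → X x ≡ false → r ⊆ᵇ X ≡ false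
⊆ᵇ-false {r = r} {X} {x} rx Xx =
  allB-false (λ j → if r j then X j else true) (trans (cong (if_then X x else true) rx) Xx)

indicator-⊆ᵇ : ∀ {n} {p : Fin n} {X : Vector Bool n} b → X p ≡ true → indicator p b ⊆ᵇ X ≡ true
indicator-⊆ᵇ {p = p} {X} false _ = allB-true λ j → cong (if_then X j else true) (indicator-false p j)
indicator-⊆ᵇ {p = p} {X} true Xp = allB-true entry
  where
  entry : ∀ j → (if indicator p true j then X j else true) ≡ true
  entry j with p ≟ j
  ... | yes refl = trans (cong (if_then X p else true) (indicator-at p true)) Xp
  ... | no  p≢j  = cong (if_then X j else true) (indicator-≢ true p≢j)

_≐_ : ∀ {n} → Rel n → Rel n → Set
F ≐ F′ = ∀ i j → F i j ≡ F′ i j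

extend : ∀ {n} → Fin (suc n) → Vector Bool (suc n) → Vector Bool n → Rel n → Rel (suc n)
extend u r B C = insertAt (λ i → insertAt (C i) u (B i)) u r

∑-allRels-extend : ∀ {n} (u : Fin (suc n)) (g : Rel (suc n) → ℤ) → Congruent _≐_ _≡_ g →
  ∑ (allRels (suc n)) g ≡
  ∑[ r ∈ allFuns (suc n) bools ] ∑[ B ∈ allFuns n bools ] ∑[ C ∈ allRels n ] g (extend u r B C)
∑-allRels-extend {n} u g g-cong =
  trans (allFuns-splits-insertAt (RowSetoid (suc n)) u (allFuns (suc n) bools) g g-cong)
    (∑-cong (allFuns (suc n) bools) λ r →
      allFuns-splits-pointwise (RowSetoid (suc n)) (setoid Bool) (RowSetoid n)
        {allFuns (suc n) bools} {bools} {allFuns n bools} {λ b c → insertAt c u b}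
        (λ b≡ C≋ → insertAt-cong (setoid Bool) u C≋ b≡) (allFuns-splits-insertAt (setoid Bool) u bools) n _
        (λ R≋ → g-cong (insertAt-cong (RowSetoid (suc n)) u R≋ (λ _ → refl))))

extend-cong : ∀ {n} (u : Fin (suc n)) {r r′ : Vector Bool (suc n)} {B B′ : Vector Bool n} {C C′ : Rel n} →
  r ≗ r′ → B ≗ B′ → C ≐ C′ → extend u r B C ≐ extend u r′ B′ C′
extend-cong {n} u r≗r′ B≗B′ C≐C′ =
  insertAt-cong (RowSetoid (suc n)) u (λ i → insertAt-cong (setoid Bool) u (C≐C′ i) (B≗B′ i)) r≗r′

eulerianWithB : ∀ {n} → Vector ℕ n → Vector ℕ n → Rel n → Bool
eulerianWithB α β F = allB (λ v → α v + outdeg F v ≡ᵇ β v + indeg F v)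

eulerianWithB-cong : ∀ {n} {α α′ β β′ : Vector ℕ n} (F : Rel n) → α ≗ α′ → β ≗ β′ →
  eulerianWithB α β F ≡ eulerianWithB α′ β′ F
eulerianWithB-cong F α≗α′ β≗β′ =
  allB-cong λ v → cong₂ (λ a b → a + outdeg F v ≡ᵇ b + indeg F v) (α≗α′ v) (β≗β′ v)

module _ {n} (u : Fin (suc n)) (r : Vector Bool (suc n)) (B : Vector Bool n) (C : Rel n) where

  private
    F : Rel (suc n)
    F = extend u r B C

  extend-row : F u ≡ r
  extend-row = insertAt-lookup _ u r

  extend-row-punchIn : ∀ i → F (punchIn u i) ≡ insertAt (C i) u (B i)
  extend-row-punchIn = insertAt-punchIn _ u r

  extend-column : ∀ i → F (punchIn u i) u ≡ B i
  extend-column i = trans (cong (λ row → row u) (extend-row-punchIn i)) (insertAt-lookup (C i) u (B i))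

  extend-punchIn : ∀ i j → F (punchIn u i) (punchIn u j) ≡ C i j
  extend-punchIn i j =
    trans (cong (λ row → row (punchIn u j)) (extend-row-punchIn i)) (insertAt-punchIn (C i) u (B i) j)

  subB-extend : (D : Rel (suc n)) → subB F D ≡
    r ⊆ᵇ D u ∧ (B ⊆ᵇ (λ i → D (punchIn u i) u) ∧ subB C (deleteVertex u D))
  subB-extend D = begin
      subB F D
    ≡⟨ allB-removeAt (λ x → F x ⊆ᵇ D x) u ⟩
      F u ⊆ᵇ D u ∧ allB (λ i → F (punchIn u i) ⊆ᵇ D (punchIn u i))
    ≡⟨ cong₂ _∧_ (⊆ᵇ-cong {X = D u} (λ j → cong (λ row → row j) extend-row)) (allB-cong row-punchIn) ⟩
      r ⊆ᵇ D u ∧ allB (λ i → column i ∧ C i ⊆ᵇ deleteVertex u D i)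
    ≡⟨ cong (r ⊆ᵇ D u ∧_) (allB-∧ column (λ i → C i ⊆ᵇ deleteVertex u D i)) ⟩
      r ⊆ᵇ D u ∧ (B ⊆ᵇ (λ i → D (punchIn u i) u) ∧ subB C (deleteVertex u D))
    ∎
    where
    open ≡-Reasoning
    column : Vector Bool n
    column i = if B i then D (punchIn u i) u else true
    row-punchIn : ∀ i → F (punchIn u i) ⊆ᵇ D (punchIn u i) ≡ column i ∧ C i ⊆ᵇ deleteVertex u D i
    row-punchIn i = trans (allB-removeAt (λ y → if F (punchIn u i) y then D (punchIn u i) y else true) u)
      (cong₂ _∧_ (cong (if_then D (punchIn u i) u else true) (extend-column i))
                 (⊆ᵇ-cong {X = deleteVertex u D i} (extend-punchIn i)))

  outdeg-extend-punchIn : ∀ i → outdeg F (punchIn u i) ≡ bit (B i) + outdeg C i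
  outdeg-extend-punchIn i = trans (cong count (extend-row-punchIn i)) (count-insertAt (C i) u (B i))

  indeg-extend : indeg F u ≡ bit (r u) + count B
  indeg-extend = trans (count-removeAt (λ x → F x u) u)
    (cong₂ _+_ (cong (λ row → bit (row u)) extend-row) (count-cong extend-column))

  indeg-extend-punchIn : ∀ i → indeg F (punchIn u i) ≡ bit (r (punchIn u i)) + indeg C i
  indeg-extend-punchIn i = trans (count-removeAt (λ x → F x (punchIn u i)) u)
    (cong₂ _+_ (cong (λ row → bit (row (punchIn u i))) extend-row) (count-cong λ j → extend-punchIn j i))

  eulerianWithB-extend : (α β : Vector ℕ (suc n)) → eulerianWithB α β F ≡
    (α u + count r ≡ᵇ β u + (bit (r u) + count B)) ∧
    eulerianWithB (λ i → α (punchIn u i) + bit (B i)) (λ i → β (punchIn u i) + bit (r (punchIn u i))) C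
  eulerianWithB-extend α β = trans (allB-removeAt (λ v → α v + outdeg F v ≡ᵇ β v + indeg F v) u)
    (cong₂ _∧_ (cong₂ (λ x y → α u + x ≡ᵇ β u + y) (cong count extend-row) indeg-extend)
               (allB-cong λ i → cong₂ _≡ᵇ_
                 (trans (cong (α (punchIn u i) +_) (outdeg-extend-punchIn i))
                        (sym (ℕ.+-assoc (α (punchIn u i)) (bit (B i)) (outdeg C i))))
                 (trans (cong (β (punchIn u i) +_) (indeg-extend-punchIn i))
                        (sym (ℕ.+-assoc (β (punchIn u i)) (bit (r (punchIn u i))) (indeg C i))))))

  arcCount-extend : arcCount F ≡ count r + (count B + arcCount C)
  arcCount-extend = trans (sumℕ-removeAt (outdeg F) u) (cong₂ _+_ (cong count extend-row)
    (trans (sumℕ-cong outdeg-extend-punchIn)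
      (trans (sumℕ-+ (bit ∘ B) (outdeg C)) (cong (_+ arcCount C) (sumℕ-bit B)))))

-- Deleting a vertex with a single out-neighbour and a single in-neighbour

weight : ∀ {n} → Vector ℕ n → Vector ℕ n → Rel n → Rel n → ℤ
weight α β D F = if subB F D ∧ eulerianWithB α β F then sign (arcCount F) else 0ℤ

diffWith : ∀ {n} → Vector ℕ n → Vector ℕ n → Rel n → ℤ
diffWith α β D = ∑ (allRels _) (weight α β D)

weight-cong : ∀ {n} (α β : Vector ℕ n) (D : Rel n) {F F′ : Rel n} → F ≐ F′ →
  weight α β D F ≡ weight α β D F′
weight-cong α β D F≐F′ = cong₂ (λ c k → if c then sign k else 0ℤ)
  (cong₂ _∧_ (allB-cong λ i → ⊆ᵇ-cong (F≐F′ i))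
             (allB-cong λ v → cong₂ (λ o i → α v + o ≡ᵇ β v + i)
                                    (count-cong (F≐F′ v)) (count-cong λ u → F≐F′ u v)))
  (sumℕ-cong λ v → count-cong (F≐F′ v))

weight-outside : ∀ {n} (α β : Vector ℕ n) (D F : Rel n) → subB F D ≡ false → weight α β D F ≡ 0ℤ
weight-outside α β D F F⊈D rewrite F⊈D = refl

diffWith-cong : ∀ {n} {α α′ β β′ : Vector ℕ n} (D : Rel n) → α ≗ α′ → β ≗ β′ →
  diffWith α β D ≡ diffWith α′ β′ D
diffWith-cong D α≗α′ β≗β′ = ∑-cong (allRels _) λ F →
  cong (λ e → if subB F D ∧ e then sign (arcCount F) else 0ℤ) (eulerianWithB-cong F α≗α′ β≗β′)

sign-suc : ∀ k → sign (suc k) ≡ - sign k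
sign-suc zero          = refl
sign-suc (suc zero)    = refl
sign-suc (suc (suc k)) = sign-suc k

sign-+ : ∀ k l → sign (k + l) ≡ sign k * sign l
sign-+ zero          l = sym (ℤ.*-identityˡ (sign l))
sign-+ (suc zero)    l = trans (sign-suc l) (sym (ℤ.-1*i≡-i (sign l)))
sign-+ (suc (suc k)) l = sign-+ k l

if-sign-split : ∀ s c e k l m →
  (if s ∧ (c ∧ e) then sign (k + (l + m)) else 0ℤ) ≡
  (if c then sign (k + l) * (if s ∧ e then sign m else 0ℤ) else 0ℤ)
if-sign-split false true  e k l m = sym (ℤ.*-zeroʳ (sign (k + l)))
if-sign-split false false e k l m = refl
if-sign-split true  false e k l m = refl
if-sign-split true  true  false k l m = sym (ℤ.*-zeroʳ (sign (k + l)))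
if-sign-split true  true  true  k l m = trans (cong sign (sym (ℕ.+-assoc k l m))) (sign-+ (k + l) m)

≡ᵇ-cancelˡ : ∀ m x y → (m + x ≡ᵇ m + y) ≡ (x ≡ᵇ y)
≡ᵇ-cancelˡ zero    x y = refl
≡ᵇ-cancelˡ (suc m) x y = ≡ᵇ-cancelˡ m x y

bump : ∀ {n} → Fin n → Bool → Vector ℕ n → Vector ℕ n
bump q b α i = α i + bit (indicator q b i)

bump-false : ∀ {n} (q : Fin n) (α : Vector ℕ n) → bump q false α ≗ α
bump-false q α i = trans (cong (λ x → α i + bit x) (indicator-false q i)) (ℕ.+-identityʳ (α i))

OnlyOutNeighbour : ∀ {n} → Rel n → Fin n → Fin n → Set
OnlyOutNeighbour D u w = ∀ v → D u v ≡ true ⇔ v ≡ w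

OnlyInNeighbour : ∀ {n} → Rel n → Fin n → Fin n → Set
OnlyInNeighbour D u w = ∀ v → D v u ≡ true ⇔ v ≡ w

module _ {n} (α β : Vector ℕ (suc n)) (D : Rel (suc n)) {u p q : Fin (suc n)}
         (u≢p : u ≢ p) (u≢q : u ≢ q) (out : OnlyOutNeighbour D u p) (inn : OnlyInNeighbour D u q) where

  private
    D′ : Rel n
    D′ = deleteVertex u D
    p′ q′ : Fin n
    p′ = punchOut u≢p
    q′ = punchOut u≢q
    w : Rel (suc n) → ℤ
    w = weight α β D
    reduced : Bool → Bool → ℤ
    reduced a b = diffWith (bump q′ b (removeAt α u)) (bump p′ a (removeAt β u)) D′

    no-other-out : ∀ {x} → p ≢ x → D u x ≡ false
    no-other-out {x} p≢x = ¬-not (λ Dux → p≢x (sym (to (out x) Dux)))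

    no-other-in : ∀ {x} → q ≢ x → D x u ≡ false
    no-other-in {x} q≢x = ¬-not (λ Dxu → q≢x (sym (to (inn x) Dxu)))

    outside-row : ∀ r B C {x} → p ≢ x → r x ≡ true → w (extend u r B C) ≡ 0ℤ
    outside-row r B C p≢x rx = weight-outside α β D (extend u r B C) (trans (subB-extend u r B C D)
      (cong (_∧ (B ⊆ᵇ (λ i → D (punchIn u i) u) ∧ subB C D′))
            (⊆ᵇ-false {r = r} {X = D u} rx (no-other-out p≢x))))

    outside-column : ∀ r B C {x} → q′ ≢ x → B x ≡ true → w (extend u r B C) ≡ 0ℤ
    outside-column r B C q′≢x Bx = weight-outside α β D (extend u r B C) (trans (subB-extend u r B C D)
      (trans (cong (λ y → r ⊆ᵇ D u ∧ (y ∧ subB C D′))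
                   (⊆ᵇ-false {r = B} {X = λ i → D (punchIn u i) u} Bx
                     (no-other-in (q′≢x ∘ sym ∘ punchIn≡⇒≡punchOut u≢q ∘ sym))))
             (∧-zeroʳ (r ⊆ᵇ D u))))

    weight-extend : ∀ a b C → w (extend u (indicator p a) (indicator q′ b) C) ≡
      (if α u + bit a ≡ᵇ β u + bit b
       then sign (bit a + bit b) * weight (bump q′ b (removeAt α u)) (bump p′ a (removeAt β u)) D′ C
       else 0ℤ)
    weight-extend a b C = trans
      (cong₂ (λ c k → if c then sign k else 0ℤ) (cong₂ _∧_ sub eul) arcs)
      (if-sign-split (subB C D′) (α u + bit a ≡ᵇ β u + bit b)
        (eulerianWithB (bump q′ b (removeAt α u)) (bump p′ a (removeAt β u)) C) (bit a) (bit b) (arcCount C))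
      where
      r : Vector Bool (suc n)
      r = indicator p a
      B : Vector Bool n
      B = indicator q′ b
      Dq′u : D (punchIn u q′) u ≡ true
      Dq′u = subst (λ x → D x u ≡ true) (sym (punchIn-punchOut u≢q)) (from (inn q) refl)
      sub : subB (extend u r B C) D ≡ subB C D′
      sub = trans (subB-extend u r B C D) (cong₂ (λ x y → x ∧ (y ∧ subB C D′))
        (indicator-⊆ᵇ {p = p} {X = D u} a (from (out p) refl))
        (indicator-⊆ᵇ {p = q′} {X = λ i → D (punchIn u i) u} b Dq′u))
      eul : eulerianWithB α β (extend u r B C) ≡
        (α u + bit a ≡ᵇ β u + bit b) ∧ eulerianWithB (bump q′ b (removeAt α u)) (bump p′ a (removeAt β u)) C
      eul = trans (eulerianWithB-extend u r B C α β) (cong₂ _∧_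
        (cong₂ (λ x y → α u + x ≡ᵇ β u + y) (count-indicator p a)
               (cong₂ _+_ (cong bit (indicator-≢ a (u≢p ∘ sym))) (count-indicator q′ b)))
        (eulerianWithB-cong {α = bump q′ b (removeAt α u)} C (λ _ → refl)
          (λ i → cong (λ x → β (punchIn u i) + bit x) (indicator-punchIn u≢p a i))))
      arcs : arcCount (extend u r B C) ≡ bit a + (bit b + arcCount C)
      arcs = trans (arcCount-extend u r B C)
        (cong₂ _+_ (count-indicator p a) (cong (_+ arcCount C) (count-indicator q′ b)))

  diffWith-deleteVertex : diffWith α β D ≡
    ∑[ a ∈ bools ] ∑[ b ∈ bools ]
      (if α u + bit a ≡ᵇ β u + bit b
       then sign (bit a + bit b) * diffWith (bump q′ b (removeAt α u)) (bump p′ a (removeAt β u)) D′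
       else 0ℤ)
  diffWith-deleteVertex = begin
      diffWith α β D
    ≡⟨ ∑-allRels-extend u w (weight-cong α β D) ⟩
      ∑[ r ∈ allFuns (suc n) bools ] ∑[ B ∈ allFuns n bools ] ∑[ C ∈ allRels n ] w (extend u r B C)
    ≡⟨ ∑-allFuns-indicator p _
         (λ r≋ → ∑-cong (allFuns n bools) λ B → ∑-cong (allRels n) λ C →
           weight-cong α β D (extend-cong u r≋ (λ _ → refl) (λ _ _ → refl)))
         (λ r x p≢x rx → ∑-zero (allFuns n bools) λ B → ∑-zero (allRels n) λ C →
           outside-row r B C p≢x rx) ⟩
      ∑[ a ∈ bools ] ∑[ B ∈ allFuns n bools ] ∑[ C ∈ allRels n ] w (extend u (indicator p a) B C)
    ≡⟨ ∑-cong bools (λ a → ∑-allFuns-indicator q′ _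
         (λ B≋ → ∑-cong (allRels n) λ C →
           weight-cong α β D (extend-cong u (λ _ → refl) B≋ (λ _ _ → refl)))
         (λ B x q′≢x Bx → ∑-zero (allRels n) λ C → outside-column (indicator p a) B C q′≢x Bx)) ⟩
      ∑[ a ∈ bools ] ∑[ b ∈ bools ] ∑[ C ∈ allRels n ] w (extend u (indicator p a) (indicator q′ b) C)
    ≡⟨ ∑-cong bools (λ a → ∑-cong bools λ b →
         trans (∑-cong (allRels n) (weight-extend a b))
               (∑-if-*ˡ (α u + bit a ≡ᵇ β u + bit b) (sign (bit a + bit b)) (allRels n) _)) ⟩
      ∑[ a ∈ bools ] ∑[ b ∈ bools ]
        (if α u + bit a ≡ᵇ β u + bit b then sign (bit a + bit b) * reduced a b else 0ℤ)
    ∎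
    where open ≡-Reasoning

  private
    diffWith-deleteVertex′ : (c : Bool → Bool → Bool) →
      (∀ a b → (α u + bit a ≡ᵇ β u + bit b) ≡ c a b) →
      diffWith α β D ≡ ∑[ a ∈ bools ] ∑[ b ∈ bools ] (if c a b then sign (bit a + bit b) * reduced a b else 0ℤ)
    diffWith-deleteVertex′ c balance = trans diffWith-deleteVertex (∑-cong bools λ a → ∑-cong bools λ b →
      cong (if_then sign (bit a + bit b) * reduced a b else 0ℤ) (balance a b))

  diffWith-deleteVertex-balanced : α u ≡ β u → diffWith α β D ≡
    diffWith (removeAt α u) (removeAt β u) D′ +ℤ
    diffWith (bump q′ true (removeAt α u)) (bump p′ true (removeAt β u)) D′
  diffWith-deleteVertex-balanced αu≡βu = begin
      diffWith α β D
    ≡⟨ diffWith-deleteVertex′ (λ a b → bit a ≡ᵇ bit b) (λ a b →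
         trans (cong (λ m → m + bit a ≡ᵇ β u + bit b) αu≡βu) (≡ᵇ-cancelˡ (β u) (bit a) (bit b))) ⟩
      ∑[ a ∈ bools ] ∑[ b ∈ bools ] (if bit a ≡ᵇ bit b then sign (bit a + bit b) * reduced a b else 0ℤ)
    ≡⟨ both-or-neither (reduced true true) (reduced false false) ⟩
      reduced false false +ℤ reduced true true
    ≡⟨ cong (_+ℤ reduced true true)
         (diffWith-cong D′ (bump-false q′ (removeAt α u)) (bump-false p′ (removeAt β u))) ⟩
      diffWith (removeAt α u) (removeAt β u) D′ +ℤ reduced true true
    ∎
    where
    open ≡-Reasoning
    both-or-neither : ∀ x y → (1ℤ * x +ℤ (0ℤ +ℤ 0ℤ)) +ℤ ((0ℤ +ℤ (1ℤ * y +ℤ 0ℤ)) +ℤ 0ℤ) ≡ y +ℤ x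
    both-or-neither = solve-∀

  diffWith-deleteVertex-surplus : α u ≡ suc (β u) → diffWith α β D ≡
    - diffWith (bump q′ true (removeAt α u)) (removeAt β u) D′
  diffWith-deleteVertex-surplus αu≡1+βu = begin
      diffWith α β D
    ≡⟨ diffWith-deleteVertex′ (λ a b → suc (bit a) ≡ᵇ bit b) (λ a b →
         trans (cong (λ m → m + bit a ≡ᵇ β u + bit b) αu≡1+βu)
           (trans (cong (_≡ᵇ β u + bit b) (sym (ℕ.+-suc (β u) (bit a))))
                  (≡ᵇ-cancelˡ (β u) (suc (bit a)) (bit b)))) ⟩
      ∑[ a ∈ bools ] ∑[ b ∈ bools ] (if suc (bit a) ≡ᵇ bit b then sign (bit a + bit b) * reduced a b else 0ℤ)
    ≡⟨ only-in-arc (reduced false true) ⟩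
      - reduced false true
    ≡⟨ cong -_ (diffWith-cong {α = bump q′ true (removeAt α u)} D′ (λ _ → refl)
                              (bump-false p′ (removeAt β u))) ⟩
      - diffWith (bump q′ true (removeAt α u)) (removeAt β u) D′
    ∎
    where
    open ≡-Reasoning
    only-in-arc : ∀ x → (0ℤ +ℤ (0ℤ +ℤ 0ℤ)) +ℤ ((-1ℤ * x +ℤ (0ℤ +ℤ 0ℤ)) +ℤ 0ℤ) ≡ - x
    only-in-arc = solve-∀

deleteVertex-punchOut-row : ∀ {n} (D : Rel (suc n)) {u x : Fin (suc n)} (u≢x : u ≢ x) v →
  deleteVertex u D (punchOut u≢x) v ≡ D x (punchIn u v)
deleteVertex-punchOut-row D {u} u≢x v = cong (λ y → D y (punchIn u v)) (punchIn-punchOut u≢x)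

deleteVertex-punchOut-column : ∀ {n} (D : Rel (suc n)) {u x : Fin (suc n)} (u≢x : u ≢ x) v →
  deleteVertex u D v (punchOut u≢x) ≡ D (punchIn u v) x
deleteVertex-punchOut-column D {u} u≢x v = cong (D (punchIn u v)) (punchIn-punchOut u≢x)

onlyOut-deleteVertex : ∀ {n} {D : Rel (suc n)} {u x w : Fin (suc n)} (u≢x : u ≢ x) (u≢w : u ≢ w) →
  (∀ v → D x v ≡ true ⇔ (v ≡ u ⊎ v ≡ w)) →
  OnlyOutNeighbour (deleteVertex u D) (punchOut u≢x) (punchOut u≢w)
onlyOut-deleteVertex {D = D} {u} {x} {w} u≢x u≢w out v = mk⇔
  (λ d → [ (λ v≡u → contradiction v≡u (punchInᵢ≢i u v)) , punchIn≡⇒≡punchOut u≢w ]′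
           (to (out (punchIn u v)) (trans (sym (deleteVertex-punchOut-row D u≢x v)) d)))
  (λ { refl → trans (deleteVertex-punchOut-row D u≢x v)
                    (subst (λ y → D x y ≡ true) (sym (punchIn-punchOut u≢w)) (from (out w) (inj₂ refl))) })

onlyIn-deleteVertex : ∀ {n} {D : Rel (suc n)} {u x w : Fin (suc n)} (u≢x : u ≢ x) (u≢w : u ≢ w) →
  OnlyInNeighbour D x w → OnlyInNeighbour (deleteVertex u D) (punchOut u≢x) (punchOut u≢w)
onlyIn-deleteVertex {D = D} {u} {x} {w} u≢x u≢w inn v = mk⇔
  (λ d → punchIn≡⇒≡punchOut u≢w
           (to (inn (punchIn u v)) (trans (sym (deleteVertex-punchOut-column D u≢x v)) d)))
  (λ { refl → trans (deleteVertex-punchOut-column D u≢x v)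
                    (subst (λ y → D y x ≡ true) (sym (punchIn-punchOut u≢w)) (from (inn w) refl)) })

diff-delete2 : ∀ {m} (D : Rel (suc (suc m))) {u₁ u₂ u₃ u₄ : Fin (suc (suc m))}
  (u₁≢u₂ : u₁ ≢ u₂) (u₁≢u₃ : u₁ ≢ u₃) (u₂≢u₃ : u₂ ≢ u₃) →
  OnlyOutNeighbour D u₁ u₃ → OnlyInNeighbour D u₁ u₂ →
  (∀ v → D u₂ v ≡ true ⇔ (v ≡ u₁ ⊎ v ≡ u₃)) → OnlyInNeighbour D u₂ u₄ →
  diff D ≡ diff (delete2 u₁ u₂ u₁≢u₂ D)
diff-delete2 {m} D {u₁} {u₂} {u₃} {u₄} u₁≢u₂ u₁≢u₃ u₂≢u₃ out₁ in₁ out₂ in₂ = begin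
    diff D
  ≡⟨⟩
    diffWith 0̂ 0̂ D
  ≡⟨ diffWith-deleteVertex-balanced 0̂ 0̂ D u₁≢u₃ u₁≢u₂ out₁ in₁ refl ⟩
    diffWith 0̂ 0̂ D₁ +ℤ diffWith (bump q₁ true 0̂) (bump p₁ true 0̂) D₁
  ≡⟨ cong₂ _+ℤ_ (diffWith-deleteVertex-balanced 0̂ 0̂ D₁ q₁≢p₁ q₁≢w₄ out₂′ in₂′ refl) through-u₁ ⟩
    (diff D′ +ℤ Y) +ℤ - Y
  ≡⟨ cancel (diff D′) Y ⟩
    diff D′
  ∎
  where
  open ≡-Reasoning
  0̂ : ∀ {n} → Vector ℕ n
  0̂ _ = 0
  D₁ : Rel (suc m)
  D₁ = deleteVertex u₁ D
  D′ : Rel m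
  D′ = delete2 u₁ u₂ u₁≢u₂ D
  u₁≢u₄ : u₁ ≢ u₄
  u₁≢u₄ u₁≡u₄ =
    u₂≢u₃ (to (out₁ u₂) (subst (λ x → D x u₂ ≡ true) (sym u₁≡u₄) (from (in₂ u₄) refl)))
  u₂≢u₄ : u₂ ≢ u₄
  u₂≢u₄ u₂≡u₄ = [ u₁≢u₂ ∘ sym , u₂≢u₃ ]′ (to (out₂ u₂) (from (in₂ u₂) u₂≡u₄))
  q₁ p₁ w₄ : Fin (suc m)
  q₁ = punchOut u₁≢u₂
  p₁ = punchOut u₁≢u₃
  w₄ = punchOut u₁≢u₄
  q₁≢p₁ : q₁ ≢ p₁
  q₁≢p₁ = u₂≢u₃ ∘ punchOut-injective u₁≢u₂ u₁≢u₃
  q₁≢w₄ : q₁ ≢ w₄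
  q₁≢w₄ = u₂≢u₄ ∘ punchOut-injective u₁≢u₂ u₁≢u₄
  out₂′ : OnlyOutNeighbour D₁ q₁ p₁
  out₂′ = onlyOut-deleteVertex {D = D} u₁≢u₂ u₁≢u₃ out₂
  in₂′ : OnlyInNeighbour D₁ q₁ w₄
  in₂′ = onlyIn-deleteVertex {D = D} u₁≢u₂ u₁≢u₄ in₂
  Y : ℤ
  Y = diffWith (bump (punchOut q₁≢w₄) true 0̂) (bump (punchOut q₁≢p₁) true 0̂) D′
  through-u₁ : diffWith (bump q₁ true 0̂) (bump p₁ true 0̂) D₁ ≡ - Y
  through-u₁ = trans
    (diffWith-deleteVertex-surplus (bump q₁ true 0̂) (bump p₁ true 0̂) D₁ q₁≢p₁ q₁≢w₄ out₂′ in₂′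
      (trans (cong bit (indicator-at q₁ true)) (cong (suc ∘ bit) (sym (indicator-≢ true (q₁≢p₁ ∘ sym))))))
    (cong -_ (diffWith-cong D′
      (λ i → cong (λ x → bit x + bit (indicator (punchOut q₁≢w₄) true i))
                  (indicator-≢ true (punchInᵢ≢i q₁ i ∘ sym)))
      (λ i → cong bit (indicator-punchIn q₁≢p₁ true i))))
  cancel : ∀ x y → (x +ℤ y) +ℤ - y ≡ x
  cancel = solve-∀

orientation-asym : ∀ {n} {G D : Rel n} {x y} → IsOrientation G D → D x y ≡ true → D y x ≡ true → ⊥
orientation-asym {x = x} {y} (D⊆G , oriented) Dxy Dyx
  with trans (sym (oriented x y (D⊆G x y Dxy))) (cong₂ _xor_ Dxy Dyx)
... | ()

orientation-neighbourhoods : ∀ {n} {G D : Rel n} {u : Fin n} {Out In : Fin n → Set} →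
  (∀ x y → G x y ≡ G y x) → IsOrientation G D →
  (∀ v → G u v ≡ true → Out v ⊎ In v) → (∀ v → Out v → D u v ≡ true) → (∀ v → In v → D v u ≡ true) →
  (∀ v → D u v ≡ true ⇔ Out v) × (∀ v → D v u ≡ true ⇔ In v)
orientation-neighbourhoods {u = u} G-sym orient@(D⊆G , _) nbrs out inn =
  (λ v → mk⇔ (λ Duv → [ id , ⊥-elim ∘ orientation-asym orient Duv ∘ inn v ]′ (nbrs v (D⊆G u v Duv)))
             (out v)) ,
  (λ v → mk⇔ (λ Dvu → [ ⊥-elim ∘ orientation-asym orient Dvu ∘ out v , id ]′
                          (nbrs v (trans (G-sym u v) (D⊆G v u Dvu))))
             (inn v))

lemma2 : (m : ℕ) (G D : Rel (suc (suc m))) (u₁ u₂ u₃ u₄ : Fin (suc (suc m)))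
    → IsGraph G
    → (u₁≢u₂ : u₁ ≢ u₂) → u₁ ≢ u₃ → u₂ ≢ u₃
    → G u₁ u₂ ≡ true → G u₂ u₃ ≡ true → G u₁ u₃ ≡ true
    → degree G u₁ ≡ 2
    → degree G u₂ ≡ 3
    → (∀ w → G u₂ w ≡ true ⇔ (w ≡ u₁ ⊎ (w ≡ u₃ ⊎ w ≡ u₄)))
    → IsOrientation G D
    → D u₁ u₃ ≡ true → D u₂ u₁ ≡ true → D u₂ u₃ ≡ true → D u₄ u₂ ≡ true
    → (diff D ≡ diff (delete2 u₁ u₂ u₁≢u₂ D))
      × (IsAT D ⇔ IsAT (delete2 u₁ u₂ u₁≢u₂ D))
lemma2 m G D u₁ u₂ u₃ u₄ (G-sym , _) u₁≢u₂ u₁≢u₃ u₂≢u₃ G₁₂ _ G₁₃ deg₁ _ N₂ orient D₁₃ D₂₁ D₂₃ D₄₂ =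
  diff≡ , mk⇔ (λ at → at ∘ trans diff≡) (λ at → at ∘ trans (sym diff≡))
  where
  arcs₁ : OnlyOutNeighbour D u₁ u₃ × OnlyInNeighbour D u₁ u₂
  arcs₁ = orientation-neighbourhoods G-sym orient
    (λ v → swap ∘ count-two deg₁ G₁₂ G₁₃ u₂≢u₃) (λ { _ refl → D₁₃ }) (λ { _ refl → D₂₁ })
  arcs₂ : (∀ v → D u₂ v ≡ true ⇔ (v ≡ u₁ ⊎ v ≡ u₃)) × OnlyInNeighbour D u₂ u₄
  arcs₂ = orientation-neighbourhoods G-sym orient
    (λ v → assocˡ ∘ to (N₂ v)) (λ { _ (inj₁ refl) → D₂₁ ; _ (inj₂ refl) → D₂₃ }) (λ { _ refl → D₄₂ })
  diff≡ : diff D ≡ diff (delete2 u₁ u₂ u₁≢u₂ D)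
  diff≡ = diff-delete2 D u₁≢u₂ u₁≢u₃ u₂≢u₃ (proj₁ arcs₁) (proj₂ arcs₁) (proj₁ arcs₂) (proj₂ arcs₂)
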